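{- Let $x_1, \dots, x_k$ be pairwise distinct indeterminates and work in the matrix ring $M_{2\times 2}(\mathbb{Z}[x_1,\dots,x_k])$. For an indeterminate $t$ put $A(t) = \begin{pmatrix} t & 1 \\ 0 & 1\end{pmatrix}$. Let $n, m \geq 1$ be integers and let $i_1,\dots,i_n, j_1,\dots,j_m \in \{1,\dots,k\}$. If $$A(x_{i_1}) A(x_{i_2}) \cdots A(x_{i_n}) = A(x_{j_1}) A(x_{j_2}) \cdots A(x_{j_m}),$$ then $n = m$ and $i_1 = j_1, \dots, i_n = j_n$.
   Context: The entries of all matrices are polynomials with integer coefficients in the indeterminates $x_1,\dots,x_k$, and equality of matrices means equality of all entries as polynomials. -}

module Defs where

open import Data.Nat using (ℕ; zero; suc)
import Data.Nat as ℕ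
open import Data.Fin using (Fin)
import Data.Fin as Fin
open import Data.Integer using (ℤ; +_; 0ℤ; 1ℤ)
import Data.Integer as ℤ
open import Data.Vec using (Vec; replicate; tabulate; zipWith)
open import Data.Vec.Properties using (≡-dec)
open import Data.List using (List; []; _∷_; _++_; map; concatMap; foldr)
open import Data.Product using (_×_; _,_)
open import Data.Bool using (if_then_else_)
open import Relation.Nullary.Decidable using (⌊_⌋)
open import Relation.Binary.PropositionalEquality using (_≡_)

-- Polynomials in Z[x_1,...,x_k], represented as finite lists of terms
-- (coefficient, exponent vector); equality is equality of all coefficients.
Monomial : ℕ → Set
Monomial k = Vec ℕ k

Poly : ℕ → Set
Poly k = List (ℤ × Monomial k)

const : ∀ {k} → ℤ → Poly k
const {k} c = (c , replicate k 0) ∷ []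

var : ∀ {k} → Fin k → Poly k
var i = (1ℤ , tabulate (λ j → if ⌊ i Fin.≟ j ⌋ then 1 else 0)) ∷ []

_⊕_ : ∀ {k} → Poly k → Poly k → Poly k
p ⊕ q = p ++ q

_⊗_ : ∀ {k} → Poly k → Poly k → Poly k
p ⊗ q = concatMap (λ { (a , e) → map (λ { (b , f) → (a ℤ.* b , zipWith ℕ._+_ e f) }) q }) p

coeff : ∀ {k} → Poly k → Monomial k → ℤ
coeff p e = foldr (λ { (a , f) acc → if ⌊ ≡-dec ℕ._≟_ f e ⌋ then a ℤ.+ acc else acc }) 0ℤ p

_≈P_ : ∀ {k} → Poly k → Poly k → Set
p ≈P q = ∀ e → coeff p e ≡ coeff q e

record Mat2 (k : ℕ) : Set where
  constructor mat
  field
    a11 a12 a21 a22 : Poly k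
open Mat2 public

_≈M_ : ∀ {k} → Mat2 k → Mat2 k → Set
M ≈M N = (a11 M ≈P a11 N) × (a12 M ≈P a12 N) × (a21 M ≈P a21 N) × (a22 M ≈P a22 N)

_⊙_ : ∀ {k} → Mat2 k → Mat2 k → Mat2 k
M ⊙ N = mat ((a11 M ⊗ a11 N) ⊕ (a12 M ⊗ a21 N)) ((a11 M ⊗ a12 N) ⊕ (a12 M ⊗ a22 N))
            ((a21 M ⊗ a11 N) ⊕ (a22 M ⊗ a21 N)) ((a21 M ⊗ a12 N) ⊕ (a22 M ⊗ a22 N))

I₂ : ∀ {k} → Mat2 k
I₂ = mat (const 1ℤ) (const 0ℤ) (const 0ℤ) (const 1ℤ)

A : ∀ {k} → Poly k → Mat2 k
A t = mat t (const 1ℤ) (const 0ℤ) (const 1ℤ)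

prodA : ∀ {k} → List (Fin k) → Mat2 k
prodA [] = I₂
prodA (i ∷ is) = A (var i) ⊙ prodA is

-- The first row of A(x_{i₁}) ⋯ A(x_{iₙ}) sums to the polynomial
-- 1 + x_{i₁} + x_{i₁}x_{i₂} + ⋯ + x_{i₁}⋯x_{iₙ}, since the bottom row of every such
-- product is (0 1). The word can be read back from this polynomial: x_{i₁} is its
-- only monomial of degree one, and the coefficients at the monomials divisible by
-- x_{i₁}, shifted down by x_{i₁}, are those of the polynomial of the tail.
module Submission where

open import Defs
open import Data.Nat using (ℕ; _≥_; suc)
import Data.Nat as ℕ
import Data.Nat.Properties as ℕ
open import Data.Fin using (Fin)
import Data.Fin as Fin
open import Data.List using (List; length; []; _∷_; _++_; [_]; map)
import Data.List.Properties as List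
open import Data.Integer using (ℤ; 0ℤ; 1ℤ; _+_; _*_)
import Data.Integer.Properties as ℤ
open import Data.Vec using ([]; _∷_; replicate; tabulate; zipWith; lookup)
import Data.Vec.Properties as Vec
open import Data.Product using (∃; _×_; _,_)
open import Data.Bool using (if_then_else_)
open import Relation.Nullary using (yes; no; ¬_; contradiction)
open import Relation.Nullary.Decidable using (⌊_⌋)
open import Relation.Binary.PropositionalEquality using (_≡_; refl; sym; trans; cong; cong₂; subst; ≡-≟-identity; ≢-≟-identity; module ≡-Reasoning)
open ≡-Reasoning

private
  variable
    k : ℕ

infixl 6 _+ᵐ_

_+ᵐ_ : Monomial k → Monomial k → Monomial k
_+ᵐ_ = zipWith ℕ._+_

𝟘 : Monomial k
𝟘 {k} = replicate k 0

-- Spelled exactly as in var i, so that var i is definitionally [ (1ℤ , unit i) ].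
unit : Fin k → Monomial k
unit i = tabulate (λ j → if ⌊ i Fin.≟ j ⌋ then 1 else 0)

_∣ᵐ_ : Monomial k → Monomial k → Set
u ∣ᵐ x = ∃ λ g → u +ᵐ g ≡ x

+ᵐ-identityˡ : (e : Monomial k) → 𝟘 +ᵐ e ≡ e
+ᵐ-identityˡ = Vec.zipWith-identityˡ ℕ.+-identityˡ

+ᵐ-identityʳ : (e : Monomial k) → e +ᵐ 𝟘 ≡ e
+ᵐ-identityʳ = Vec.zipWith-identityʳ ℕ.+-identityʳ

+ᵐ-cancelˡ : (u f g : Monomial k) → u +ᵐ f ≡ u +ᵐ g → f ≡ g
+ᵐ-cancelˡ [] [] [] _ = refl
+ᵐ-cancelˡ (a ∷ u) (b ∷ f) (c ∷ g) eq =
  cong₂ _∷_ (ℕ.+-cancelˡ-≡ a b c (Vec.∷-injectiveˡ eq)) (+ᵐ-cancelˡ u f g (Vec.∷-injectiveʳ eq))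

lookup-unit-self : (i : Fin k) → lookup (unit i) i ≡ 1
lookup-unit-self i = trans (Vec.lookup∘tabulate _ i)
  (cong (λ d → if ⌊ d ⌋ then 1 else 0) (≡-≟-identity Fin._≟_ refl))

lookup-unit-other : {i j : Fin k} → ¬ i ≡ j → lookup (unit i) j ≡ 0
lookup-unit-other {j = j} i≢j = trans (Vec.lookup∘tabulate _ j)
  (cong (λ d → if ⌊ d ⌋ then 1 else 0) (≢-≟-identity Fin._≟_ i≢j))

lookup-unit+ᵐ-self : (i : Fin k) (f : Monomial k) → lookup (unit i +ᵐ f) i ≡ suc (lookup f i)
lookup-unit+ᵐ-self i f = begin
  lookup (unit i +ᵐ f) i          ≡⟨ Vec.lookup-zipWith ℕ._+_ i (unit i) f ⟩
  lookup (unit i) i ℕ.+ lookup f i ≡⟨ cong (ℕ._+ lookup f i) (lookup-unit-self i) ⟩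
  suc (lookup f i)                ∎

unit-∤ᵐ-𝟘 : (i : Fin k) → ¬ unit i ∣ᵐ 𝟘
unit-∤ᵐ-𝟘 i (f , eq) with () ←
  trans (sym (lookup-unit+ᵐ-self i f)) (trans (cong (λ v → lookup v i) eq) (Vec.lookup-replicate i 0))

unit≢𝟘 : (i : Fin k) → ¬ unit i ≡ 𝟘
unit≢𝟘 i eq = unit-∤ᵐ-𝟘 i (𝟘 , trans (+ᵐ-identityʳ (unit i)) eq)

unit-∤ᵐ-unit : {i j : Fin k} → ¬ i ≡ j → ¬ unit j ∣ᵐ unit i
unit-∤ᵐ-unit {j = j} i≢j (g , eq) with () ←
  trans (sym (lookup-unit+ᵐ-self j g)) (trans (cong (λ v → lookup v j) eq) (lookup-unit-other i≢j))

coeff-⊕ : (p q : Poly k) (e : Monomial k) → coeff (p ⊕ q) e ≡ coeff p e + coeff q e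
coeff-⊕ [] q e = sym (ℤ.+-identityˡ _)
coeff-⊕ ((a , f) ∷ p) q e with Vec.≡-dec ℕ._≟_ f e
... | yes _ = trans (cong (a +_) (coeff-⊕ p q e)) (sym (ℤ.+-assoc a _ _))
... | no _ = coeff-⊕ p q e

coeff-term-⊗-shift : (a : ℤ) (u : Monomial k) (p : Poly k) (e : Monomial k) →
  coeff ([ (a , u) ] ⊗ p) (u +ᵐ e) ≡ a * coeff p e
coeff-term-⊗-shift a u [] e = sym (ℤ.*-zeroʳ a)
coeff-term-⊗-shift a u ((b , f) ∷ p) e with Vec.≡-dec ℕ._≟_ f e | Vec.≡-dec ℕ._≟_ (u +ᵐ f) (u +ᵐ e)
... | yes _   | yes _       = trans (cong (a * b +_) (coeff-term-⊗-shift a u p e)) (sym (ℤ.*-distribˡ-+ a b _))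
... | yes f≡e | no  u+f≢u+e = contradiction (cong (u +ᵐ_) f≡e) u+f≢u+e
... | no  f≢e | yes u+f≡u+e = contradiction (+ᵐ-cancelˡ u f e u+f≡u+e) f≢e
... | no  _   | no  _       = coeff-term-⊗-shift a u p e

coeff-term-⊗-∤ᵐ : (a : ℤ) (u : Monomial k) (p : Poly k) {x : Monomial k} →
  ¬ u ∣ᵐ x → coeff ([ (a , u) ] ⊗ p) x ≡ 0ℤ
coeff-term-⊗-∤ᵐ a u [] u∤x = refl
coeff-term-⊗-∤ᵐ a u ((b , f) ∷ p) {x} u∤x with Vec.≡-dec ℕ._≟_ (u +ᵐ f) x
... | yes u+f≡x = contradiction (f , u+f≡x) u∤x
... | no  _     = coeff-term-⊗-∤ᵐ a u p u∤x

term-⊗-distribˡ-⊕ : (a : ℤ) (u : Monomial k) (p q : Poly k) →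
  [ (a , u) ] ⊗ (p ⊕ q) ≡ ([ (a , u) ] ⊗ p) ⊕ ([ (a , u) ] ⊗ q)
term-⊗-distribˡ-⊕ {k} a u p q = begin
  map shift (p ++ q) ++ []                ≡⟨ List.++-identityʳ _ ⟩
  map shift (p ++ q)                      ≡⟨ List.map-++ shift p q ⟩
  map shift p ++ map shift q              ≡⟨ sym (cong₂ _++_ (List.++-identityʳ (map shift p)) (List.++-identityʳ (map shift q))) ⟩
  (map shift p ++ []) ++ (map shift q ++ []) ∎
  where
  shift : ℤ × Monomial k → ℤ × Monomial k
  shift (b , f) = a * b , u +ᵐ f

coeff-const-⊗ : (c : ℤ) (p : Poly k) (x : Monomial k) → coeff (const c ⊗ p) x ≡ c * coeff p x
coeff-const-⊗ c p x = subst (λ y → coeff (const c ⊗ p) y ≡ c * coeff p x) (+ᵐ-identityˡ x)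
  (coeff-term-⊗-shift c 𝟘 p x)

coeff-const-𝟘 : (c : ℤ) → coeff (const {k} c) 𝟘 ≡ c
coeff-const-𝟘 {k} c with Vec.≡-dec ℕ._≟_ (𝟘 {k}) 𝟘
... | yes _   = ℤ.+-identityʳ c
... | no  𝟘≢𝟘 = contradiction refl 𝟘≢𝟘

coeff-const-≢𝟘 : (c : ℤ) {x : Monomial k} → ¬ x ≡ 𝟘 → coeff (const c) x ≡ 0ℤ
coeff-const-≢𝟘 {k} c {x} x≢𝟘 with Vec.≡-dec ℕ._≟_ (𝟘 {k}) x
... | yes 𝟘≡x = contradiction (sym 𝟘≡x) x≢𝟘
... | no  _   = refl

coeff-const-0ℤ : (x : Monomial k) → coeff (const {k} 0ℤ) x ≡ 0ℤ
coeff-const-0ℤ {k} x with Vec.≡-dec ℕ._≟_ (𝟘 {k}) x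
... | yes _ = refl
... | no  _ = refl

coeff-var-⊗-shift : (i : Fin k) (p : Poly k) (e : Monomial k) →
  coeff (var i ⊗ p) (unit i +ᵐ e) ≡ coeff p e
coeff-var-⊗-shift i p e = trans (coeff-term-⊗-shift 1ℤ (unit i) p e) (ℤ.*-identityˡ _)

coeff-var-⊗-∤ᵐ : (i : Fin k) (p : Poly k) {x : Monomial k} → ¬ unit i ∣ᵐ x → coeff (var i ⊗ p) x ≡ 0ℤ
coeff-var-⊗-∤ᵐ i = coeff-term-⊗-∤ᵐ 1ℤ (unit i)

coeff-bottomRow : (p q : Poly k) (x : Monomial k) → coeff ((const 0ℤ ⊗ p) ⊕ (const 1ℤ ⊗ q)) x ≡ coeff q x
coeff-bottomRow p q x = begin
  coeff ((const 0ℤ ⊗ p) ⊕ (const 1ℤ ⊗ q)) x           ≡⟨ coeff-⊕ (const 0ℤ ⊗ p) _ x ⟩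
  coeff (const 0ℤ ⊗ p) x + coeff (const 1ℤ ⊗ q) x     ≡⟨ cong₂ _+_ (coeff-const-⊗ 0ℤ p x) (coeff-const-⊗ 1ℤ q x) ⟩
  0ℤ * coeff p x + 1ℤ * coeff q x                     ≡⟨ cong₂ _+_ (ℤ.*-zeroˡ (coeff p x)) (ℤ.*-identityˡ (coeff q x)) ⟩
  0ℤ + coeff q x                                      ≡⟨ ℤ.+-identityˡ (coeff q x) ⟩
  coeff q x                                           ∎

prodA-a21 : (is : List (Fin k)) → a21 (prodA is) ≈P const 0ℤ
prodA-a21 [] x = refl
prodA-a21 (i ∷ is) x = trans (coeff-bottomRow (a11 (prodA is)) _ x) (prodA-a21 is x)

prodA-a22 : (is : List (Fin k)) → a22 (prodA is) ≈P const 1ℤ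
prodA-a22 [] x = refl
prodA-a22 (i ∷ is) x = trans (coeff-bottomRow (a12 (prodA is)) _ x) (prodA-a22 is x)

firstRowSum : Mat2 k → Poly k
firstRowSum M = a11 M ⊕ a12 M

firstRowSum-cong : {M N : Mat2 k} → M ≈M N → firstRowSum M ≈P firstRowSum N
firstRowSum-cong {M = M} {N} (eq₁₁ , eq₁₂ , _ , _) e = begin
  coeff (firstRowSum M) e          ≡⟨ coeff-⊕ (a11 M) _ e ⟩
  coeff (a11 M) e + coeff (a12 M) e ≡⟨ cong₂ _+_ (eq₁₁ e) (eq₁₂ e) ⟩
  coeff (a11 N) e + coeff (a12 N) e ≡⟨ sym (coeff-⊕ (a11 N) _ e) ⟩
  coeff (firstRowSum N) e          ∎

coeff-firstRowSum-∷ : (i : Fin k) (is : List (Fin k)) (x : Monomial k) →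
  coeff (firstRowSum (prodA (i ∷ is))) x ≡ coeff (var i ⊗ firstRowSum (prodA is)) x + coeff (const 1ℤ) x
coeff-firstRowSum-∷ {k} i is x = begin
  coeff (((X ⊗ p₁₁) ⊕ (C ⊗ p₂₁)) ⊕ ((X ⊗ p₁₂) ⊕ (C ⊗ p₂₂))) x
    ≡⟨ coeff-⊕ ((X ⊗ p₁₁) ⊕ (C ⊗ p₂₁)) _ x ⟩
  coeff ((X ⊗ p₁₁) ⊕ (C ⊗ p₂₁)) x + coeff ((X ⊗ p₁₂) ⊕ (C ⊗ p₂₂)) x
    ≡⟨ cong₂ _+_ (coeff-⊕ (X ⊗ p₁₁) _ x) (coeff-⊕ (X ⊗ p₁₂) _ x) ⟩
  (coeff (X ⊗ p₁₁) x + coeff (C ⊗ p₂₁) x) + (coeff (X ⊗ p₁₂) x + coeff (C ⊗ p₂₂) x)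
    ≡⟨ cong₂ (λ a b → (coeff (X ⊗ p₁₁) x + a) + (coeff (X ⊗ p₁₂) x + b))
         (trans (oneTimes p₂₁) (prodA-a21 is x)) (trans (oneTimes p₂₂) (prodA-a22 is x)) ⟩
  (coeff (X ⊗ p₁₁) x + coeff (const 0ℤ) x) + (coeff (X ⊗ p₁₂) x + coeff C x)
    ≡⟨ cong (λ a → (coeff (X ⊗ p₁₁) x + a) + (coeff (X ⊗ p₁₂) x + coeff C x)) (coeff-const-0ℤ x) ⟩
  (coeff (X ⊗ p₁₁) x + 0ℤ) + (coeff (X ⊗ p₁₂) x + coeff C x)
    ≡⟨ cong (_+ (coeff (X ⊗ p₁₂) x + coeff C x)) (ℤ.+-identityʳ (coeff (X ⊗ p₁₁) x)) ⟩
  coeff (X ⊗ p₁₁) x + (coeff (X ⊗ p₁₂) x + coeff C x)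
    ≡⟨ sym (ℤ.+-assoc (coeff (X ⊗ p₁₁) x) _ _) ⟩
  (coeff (X ⊗ p₁₁) x + coeff (X ⊗ p₁₂) x) + coeff C x
    ≡⟨ cong (_+ coeff C x) (sym (coeff-⊕ (X ⊗ p₁₁) _ x)) ⟩
  coeff ((X ⊗ p₁₁) ⊕ (X ⊗ p₁₂)) x + coeff C x
    ≡⟨ cong (λ r → coeff r x + coeff C x) (sym (term-⊗-distribˡ-⊕ 1ℤ (unit i) p₁₁ p₁₂)) ⟩
  coeff (X ⊗ (p₁₁ ⊕ p₁₂)) x + coeff C x
    ∎
  where
  X = var i
  C = const 1ℤ
  p₁₁ = a11 (prodA is)
  p₁₂ = a12 (prodA is)
  p₂₁ = a21 (prodA is)
  p₂₂ = a22 (prodA is)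
  oneTimes : (p : Poly k) → coeff (C ⊗ p) x ≡ coeff p x
  oneTimes p = trans (coeff-const-⊗ 1ℤ p x) (ℤ.*-identityˡ _)

coeff-firstRowSum-𝟘 : (is : List (Fin k)) → coeff (firstRowSum (prodA is)) 𝟘 ≡ 1ℤ
coeff-firstRowSum-𝟘 {k} [] = trans (coeff-⊕ {k} (const 1ℤ) (const 0ℤ) 𝟘)
  (cong₂ _+_ (coeff-const-𝟘 {k} 1ℤ) (coeff-const-0ℤ {k} 𝟘))
coeff-firstRowSum-𝟘 (i ∷ is) = trans (coeff-firstRowSum-∷ i is 𝟘)
  (cong₂ _+_ (coeff-var-⊗-∤ᵐ i (firstRowSum (prodA is)) (unit-∤ᵐ-𝟘 i)) (coeff-const-𝟘 1ℤ))

coeff-firstRowSum-shift : (i : Fin k) (is : List (Fin k)) (e : Monomial k) →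
  coeff (firstRowSum (prodA (i ∷ is))) (unit i +ᵐ e) ≡ coeff (firstRowSum (prodA is)) e
coeff-firstRowSum-shift i is e = begin
  coeff (firstRowSum (prodA (i ∷ is))) (unit i +ᵐ e)
    ≡⟨ coeff-firstRowSum-∷ i is (unit i +ᵐ e) ⟩
  coeff (var i ⊗ firstRowSum (prodA is)) (unit i +ᵐ e) + coeff (const 1ℤ) (unit i +ᵐ e)
    ≡⟨ cong₂ _+_ (coeff-var-⊗-shift i (firstRowSum (prodA is)) e) (coeff-const-≢𝟘 1ℤ (λ eq → unit-∤ᵐ-𝟘 i (e , eq))) ⟩
  coeff (firstRowSum (prodA is)) e + 0ℤ
    ≡⟨ ℤ.+-identityʳ (coeff (firstRowSum (prodA is)) e) ⟩
  coeff (firstRowSum (prodA is)) e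
    ∎

coeff-firstRowSum-∤ᵐ : (i : Fin k) (is : List (Fin k)) {x : Monomial k} →
  ¬ unit i ∣ᵐ x → ¬ x ≡ 𝟘 → coeff (firstRowSum (prodA (i ∷ is))) x ≡ 0ℤ
coeff-firstRowSum-∤ᵐ i is {x} i∤x x≢𝟘 = trans (coeff-firstRowSum-∷ i is x)
  (cong₂ _+_ (coeff-var-⊗-∤ᵐ i (firstRowSum (prodA is)) i∤x) (coeff-const-≢𝟘 1ℤ x≢𝟘))

coeff-firstRowSum-unit-head : (i : Fin k) (is : List (Fin k)) →
  coeff (firstRowSum (prodA (i ∷ is))) (unit i) ≡ 1ℤ
coeff-firstRowSum-unit-head i is = begin
  coeff (firstRowSum (prodA (i ∷ is))) (unit i)       ≡⟨ cong (coeff (firstRowSum (prodA (i ∷ is)))) (+ᵐ-identityʳ (unit i)) ⟨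
  coeff (firstRowSum (prodA (i ∷ is))) (unit i +ᵐ 𝟘) ≡⟨ coeff-firstRowSum-shift i is 𝟘 ⟩
  coeff (firstRowSum (prodA is)) 𝟘                    ≡⟨ coeff-firstRowSum-𝟘 is ⟩
  1ℤ                                                  ∎

coeff-firstRowSum-[]-unit : (j : Fin k) → coeff (firstRowSum (prodA [])) (unit j) ≡ 0ℤ
coeff-firstRowSum-[]-unit j = trans (coeff-⊕ (const 1ℤ) (const 0ℤ) (unit j))
  (cong₂ _+_ (coeff-const-≢𝟘 1ℤ (unit≢𝟘 j)) (coeff-const-0ℤ (unit j)))

firstRowSum-prodA-injective : (is js : List (Fin k)) →
  firstRowSum (prodA is) ≈P firstRowSum (prodA js) → is ≡ js
firstRowSum-prodA-injective [] [] _ = refl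
firstRowSum-prodA-injective [] (j ∷ js) eq = contradiction
  (trans (sym (coeff-firstRowSum-[]-unit j)) (trans (eq (unit j)) (coeff-firstRowSum-unit-head j js)))
  λ ()
firstRowSum-prodA-injective (i ∷ is) [] eq = contradiction
  (trans (sym (coeff-firstRowSum-unit-head i is)) (trans (eq (unit i)) (coeff-firstRowSum-[]-unit i)))
  λ ()
firstRowSum-prodA-injective (i ∷ is) (j ∷ js) eq with i Fin.≟ j
... | no i≢j = contradiction
  (trans (sym (coeff-firstRowSum-unit-head i is))
    (trans (eq (unit i)) (coeff-firstRowSum-∤ᵐ j js (unit-∤ᵐ-unit i≢j) (unit≢𝟘 i))))
  λ ()
... | yes refl = cong (i ∷_) (firstRowSum-prodA-injective is js λ e →
  trans (sym (coeff-firstRowSum-shift i is e))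
    (trans (eq (unit i +ᵐ e)) (coeff-firstRowSum-shift i js e)))

mainTheorem1 : (k : ℕ) (is js : List (Fin k)) →
    length is ≥ 1 → length js ≥ 1 →
    prodA is ≈M prodA js → is ≡ js
mainTheorem1 k is js _ _ eq =
  firstRowSum-prodA-injective is js (firstRowSum-cong {M = prodA is} {N = prodA js} eq)
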